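{- For all integers $n\geq d\geq 1$ and all $x\in\mathbb{R}$, with the convention $j_0=0$, $$\sum_{k=d}^n\binom{n}{k}(-1)^{d-k}x^{n-k} S(k,d) = \sum_{1\leq j_1<j_2<\cdots<j_d\leq n} x^{n-j_d}\prod_{r=0}^{d-1} \bigl(x-(d-r)\bigr)^{j_{r+1}-j_{r}-1}.$$
   Context: $S(k,d)$ denotes the Stirling number of the second kind, the number of partitions of a $k$-element set into $d$ non-empty subsets. The convention $0^0=1$ is used. -}

module Defs where

open import Level using (Level)
open import Data.Nat using (ℕ; zero; suc; _∸_)
open import Data.List using (List; []; _∷_; map; concatMap; upTo)
open import Algebra.Bundles using (CommutativeRing)
open import Data.Nat.Combinatorics using (_C_)
import Data.Nat as ℕ

S : ℕ → ℕ → ℕ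
S zero    zero    = 1
S zero    (suc d) = 0
S (suc k) zero    = 0
S (suc k) (suc d) = suc d ℕ.* S k (suc d) ℕ.+ S k d

range : ℕ → ℕ → List ℕ
range a n = map (λ i → a ℕ.+ suc i) (upTo (n ∸ a))

-- chains d a n = all strictly increasing lists a < j₁ < j₂ < ... < j_d ≤ n
-- (each exactly once).
chains : ℕ → ℕ → ℕ → List (List ℕ)
chains zero    a n = [] ∷ []
chains (suc d) a n = concatMap (λ j → map (j ∷_) (chains d j n)) (range a n)

-- last element of a list (0 for the empty list; only used on nonempty lists)
lastOr0 : List ℕ → ℕ
lastOr0 []           = 0
lastOr0 (j ∷ [])     = j
lastOr0 (j ∷ k ∷ js) = lastOr0 (k ∷ js)

module RingDefs {c ℓ : Level} (R : CommutativeRing c ℓ) where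
  open CommutativeRing R 

  fromℕ : ℕ → Carrier
  fromℕ zero    = 0#
  fromℕ (suc n) = 1# + fromℕ n

  -- y ^ m with y ^ 0 = 1 (so 0^0 = 1)
  _^_ : Carrier → ℕ → Carrier
  y ^ zero  = 1#
  y ^ suc m = y * (y ^ m)

  sumR : List Carrier → Carrier
  sumR []       = 0#
  sumR (a ∷ as) = a + sumR as

  -- LHS summand for index k:  C(n,k) (-1)^(d-k) x^(n-k) S(k,d);
  -- since k ≥ d, (-1)^(d-k) = (-1)^(k-d).
  lhsTerm : ℕ → ℕ → Carrier → ℕ → Carrier
  lhsTerm n d x k = fromℕ ((n C k) ℕ.* S k d) * (((- 1#) ^ (k ∸ d)) * (x ^ (n ∸ k)))

  lhs : ℕ → ℕ → Carrier → Carrier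
  lhs n d x = sumR (map (lhsTerm n d x) (map (λ i → d ℕ.+ i) (upTo (suc n ∸ d))))

  -- ∏_{r} (x - (d - r))^(j_{r+1} - j_r - 1), walking the list j₁,…,j_d,
  -- with prev = j_r (starting at j₀ = 0) and r starting at 0.
  prodTerm : ℕ → Carrier → ℕ → ℕ → List ℕ → Carrier
  prodTerm d x prev r []       = 1#
  prodTerm d x prev r (j ∷ js) =
    ((x - fromℕ (d ∸ r)) ^ (j ∸ prev ∸ 1)) * prodTerm d x j (suc r) js

  rhsTerm : ℕ → ℕ → Carrier → List ℕ → Carrier
  rhsTerm n d x js = (x ^ (n ∸ lastOr0 js)) * prodTerm d x 0 0 js

  rhs : ℕ → ℕ → Carrier → Carrier
  rhs n d x = sumR (map (rhsTerm n d x) (chains d 0 n))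

-- Both sides equal h_{n−d}(x, x − 1, …, x − d), the complete homogeneous symmetric
-- polynomial of degree n − d in d + 1 variables.  On the right this is its expansion into
-- monomials, each written as a stars-and-bars word of length n whose d bars sit at the
-- positions j_1 < … < j_d.  On the left, Pascal's rule turns the binomial transform
-- a ↦ Σ_k C(n,k) x^{n−k} a_k into multiplication by x plus the shift a ↦ a ∘ suc, so the
-- recurrence s(k+1, d+1) = −(d+1) s(k, d+1) + s(k, d) of the signed Stirling numbers
-- becomes the recurrence h(n+1, d+1) = (x − (d+1)) h(n, d+1) + h(n, d).
module Submission where

open import Defs
open import Level using (Level)
open import Data.Nat using (ℕ; _≤_)
open import Algebra.Bundles using (CommutativeRing)

open import Data.Nat as ℕ using (zero; suc; _∸_; _<_; s≤s)
import Data.Nat.Properties as ℕ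
open import Data.Nat.Combinatorics using (_C_; nCk+nC[k+1]≡[n+1]C[k+1]; k>n⇒nCk≡0)
open import Data.Fin as Fin using (toℕ)
open import Data.Fin.Properties using (toℕ-inject₁; toℕ-fromℕ; toℕ<n)
open import Data.List using (List; []; _∷_; map; concatMap; applyUpTo; upTo; _++_)
open import Data.List.Properties using (map-∘; map-++; map-upTo)
open import Data.Sum using (inj₁; inj₂)
open import Function using (_∘_)
open import Relation.Binary.PropositionalEquality as ≡ using (_≡_)

S-vanishes : ∀ {k d} → k < d → S k d ≡ 0
S-vanishes {zero}  {suc d} _         = ≡.refl
S-vanishes {suc k} {suc d} (s≤s k<d)
  rewrite S-vanishes (ℕ.m<n⇒m<1+n k<d) | S-vanishes k<d | ℕ.*-zeroʳ d = ≡.refl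

module _ {r ℓ : Level} (R : CommutativeRing r ℓ) where
  open CommutativeRing R
  open RingDefs R
  open import Relation.Binary.Reasoning.Setoid setoid
  open import Algebra.Properties.Semiring.Sum semiring
  open import Algebra.Properties.Semiring.Mult semiring using (_×_; ×-homo-+; ×1-homo-*)
  open import Algebra.Properties.CommutativeSemigroup *-commutativeSemigroup
    using (interchange) renaming (x∙yz≈y∙xz to x*yz≈y*xz)
  open import Algebra.Properties.CommutativeSemigroup +-commutativeSemigroup
    using () renaming (x∙yz≈xz∙y to x+yz≈xz+y)
  open import Algebra.Properties.Ring ring using (-1*x≈-x; -‿distribˡ-*; -‿distribʳ-*)

  fromℕ≡×1# : ∀ n → fromℕ n ≡ n × 1#
  fromℕ≡×1# zero    = ≡.refl
  fromℕ≡×1# (suc n) = ≡.cong (1# +_) (fromℕ≡×1# n)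

  fromℕ-homo-+ : ∀ m n → fromℕ (m ℕ.+ n) ≈ fromℕ m + fromℕ n
  fromℕ-homo-+ m n rewrite fromℕ≡×1# (m ℕ.+ n) | fromℕ≡×1# m | fromℕ≡×1# n = ×-homo-+ 1# m n

  fromℕ-homo-* : ∀ m n → fromℕ (m ℕ.* n) ≈ fromℕ m * fromℕ n
  fromℕ-homo-* m n rewrite fromℕ≡×1# (m ℕ.* n) | fromℕ≡×1# m | fromℕ≡×1# n = ×1-homo-* m n

  sumR-++ : ∀ (xs ys : List Carrier) → sumR (xs ++ ys) ≈ sumR xs + sumR ys
  sumR-++ []       ys = sym (+-identityˡ _)
  sumR-++ (x ∷ xs) ys = trans (+-congˡ (sumR-++ xs ys)) (sym (+-assoc _ _ _))

  sumR-map-concatMap : ∀ {A B : Set} (f : B → Carrier) (g : A → List B) (xs : List A) →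
    sumR (map f (concatMap g xs)) ≈ sumR (map (λ y → sumR (map f (g y))) xs)
  sumR-map-concatMap f g []       = refl
  sumR-map-concatMap f g (y ∷ xs) = begin
    sumR (map f (g y ++ concatMap g xs))               ≡⟨ ≡.cong sumR (map-++ f (g y) _) ⟩
    sumR (map f (g y) ++ map f (concatMap g xs))       ≈⟨ sumR-++ (map f (g y)) _ ⟩
    sumR (map f (g y)) + sumR (map f (concatMap g xs)) ≈⟨ +-congˡ (sumR-map-concatMap f g xs) ⟩
    sumR (map (λ y → sumR (map f (g y))) (y ∷ xs))     ∎

  sumR-map-cong : ∀ {A : Set} {f g : A → Carrier} → (∀ y → f y ≈ g y) →
    ∀ xs → sumR (map f xs) ≈ sumR (map g xs)
  sumR-map-cong f≈g []       = refl
  sumR-map-cong f≈g (y ∷ xs) = +-cong (f≈g y) (sumR-map-cong f≈g xs)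

  *-distribˡ-sumR : ∀ {A : Set} a (f : A → Carrier) xs →
    a * sumR (map f xs) ≈ sumR (map (λ y → a * f y) xs)
  *-distribˡ-sumR a f []       = zeroʳ a
  *-distribˡ-sumR a f (y ∷ xs) = trans (distribˡ a _ _) (+-congˡ (*-distribˡ-sumR a f xs))

  sumR-applyUpTo : ∀ (f : ℕ → Carrier) n → sumR (applyUpTo f n) ≡ ∑[ i < n ] f (toℕ i)
  sumR-applyUpTo f zero    = ≡.refl
  sumR-applyUpTo f (suc n) = ≡.cong (f 0 +_) (sumR-applyUpTo (f ∘ suc) n)

  sumR-map-map-upTo : ∀ (f : ℕ → Carrier) (g : ℕ → ℕ) n →
    sumR (map f (map g (upTo n))) ≡ ∑[ i < n ] f (g (toℕ i))
  sumR-map-map-upTo f g n =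
    ≡.trans (≡.cong sumR (≡.trans (≡.sym (map-∘ (upTo n))) (map-upTo (f ∘ g) n)))
            (sumR-applyUpTo (f ∘ g) n)

  ∑-split : ∀ m n (f : ℕ → Carrier) →
    ∑[ i < m ℕ.+ n ] f (toℕ i) ≈ ∑[ i < m ] f (toℕ i) + ∑[ j < n ] f (m ℕ.+ toℕ j)
  ∑-split zero    n f = sym (+-identityˡ _)
  ∑-split (suc m) n f = trans (+-congˡ (∑-split m n (f ∘ suc))) (sym (+-assoc _ _ _))

  ∑-zero : ∀ n (t : Fin.Fin n → Carrier) → (∀ i → t i ≈ 0#) → ∑[ i < n ] t i ≈ 0#
  ∑-zero n t t≈0 = trans (sum-cong-≋ t≈0) (sum-replicate-zero n)

  ∑-dropLast : ∀ n (f : ℕ → Carrier) → f n ≈ 0# → ∑[ i < suc n ] f (toℕ i) ≈ ∑[ i < n ] f (toℕ i)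
  ∑-dropLast n f fn≈0 = begin
    ∑[ i < suc n ] f (toℕ i)                            ≈⟨ sum-init-last (f ∘ toℕ) ⟩
    ∑[ i < n ] f (toℕ (Fin.inject₁ i)) + f (toℕ (Fin.fromℕ n))
      ≡⟨ ≡.cong₂ _+_ (sum-cong-≗ {n} (≡.cong f ∘ toℕ-inject₁)) (≡.cong f (toℕ-fromℕ n)) ⟩
    ∑[ i < n ] f (toℕ i) + f n                          ≈⟨ +-congˡ fn≈0 ⟩
    ∑[ i < n ] f (toℕ i) + 0#                           ≈⟨ +-identityʳ _ ⟩
    ∑[ i < n ] f (toℕ i)                                ∎

  ∑-suffix : ∀ {m n} (f : ℕ → Carrier) → m ≤ n → (∀ {k} → k < m → f k ≈ 0#) →
    ∑[ i < n ∸ m ] f (m ℕ.+ toℕ i) ≈ ∑[ k < n ] f (toℕ k)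
  ∑-suffix {m} {n} f m≤n f≈0 = begin
    ∑[ i < n ∸ m ] f (m ℕ.+ toℕ i)                           ≈⟨ +-identityˡ _ ⟨
    0# + ∑[ i < n ∸ m ] f (m ℕ.+ toℕ i)                      ≈⟨ +-congʳ (∑-zero m _ (f≈0 ∘ toℕ<n)) ⟨
    ∑[ k < m ] f (toℕ k) + ∑[ i < n ∸ m ] f (m ℕ.+ toℕ i)    ≈⟨ ∑-split m (n ∸ m) f ⟨
    ∑[ k < m ℕ.+ (n ∸ m) ] f (toℕ k)                         ≡⟨ ≡.cong (λ l → ∑[ k < l ] f (toℕ k)) (ℕ.m+[n∸m]≡n m≤n) ⟩
    ∑[ k < n ] f (toℕ k)                                     ∎

  signedStirling : ℕ → ℕ → Carrier
  signedStirling k d = fromℕ (S k d) * (- 1#) ^ (k ∸ d)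

  signedStirling-vanishes : ∀ {k d} → k < d → signedStirling k d ≈ 0#
  signedStirling-vanishes {k} {d} k<d = begin
    fromℕ (S k d) * (- 1#) ^ (k ∸ d) ≡⟨ ≡.cong (λ s → fromℕ s * (- 1#) ^ (k ∸ d)) (S-vanishes k<d) ⟩
    0# * (- 1#) ^ (k ∸ d)            ≈⟨ zeroˡ _ ⟩
    0#                               ∎

  -- for k ≤ d both sides vanish; otherwise k ∸ d = 1 + (k ∸ suc d)
  S-suc*sign≈-signedStirling : ∀ k d → fromℕ (S k (suc d)) * (- 1#) ^ (k ∸ d) ≈ - signedStirling k (suc d)
  S-suc*sign≈-signedStirling k d with ℕ.≤-<-connex k d
  ... | inj₁ k≤d = begin
    fromℕ (S k (suc d)) * (- 1#) ^ (k ∸ d) ≡⟨ ≡.cong (λ s → fromℕ s * (- 1#) ^ (k ∸ d)) (S-vanishes (s≤s k≤d)) ⟩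
    0# * (- 1#) ^ (k ∸ d)                  ≈⟨ zeroˡ _ ⟩
    0#                                     ≈⟨ zeroˡ _ ⟨
    0# * - (- 1#) ^ (k ∸ suc d)            ≈⟨ -‿distribʳ-* _ _ ⟨
    - (0# * (- 1#) ^ (k ∸ suc d))
      ≡⟨ ≡.cong (λ s → - (fromℕ s * (- 1#) ^ (k ∸ suc d))) (S-vanishes (s≤s k≤d)) ⟨
    - signedStirling k (suc d)             ∎
  ... | inj₂ (s≤s {n = k′} d≤k′) = begin
    fromℕ s * (- 1#) ^ (suc k′ ∸ d)        ≡⟨ ≡.cong (λ e → fromℕ s * (- 1#) ^ e) (ℕ.+-∸-assoc 1 d≤k′) ⟩
    fromℕ s * (- 1# * (- 1#) ^ (k′ ∸ d))   ≈⟨ *-congˡ (-1*x≈-x _) ⟩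
    fromℕ s * - (- 1#) ^ (k′ ∸ d)          ≈⟨ -‿distribʳ-* _ _ ⟨
    - signedStirling (suc k′) (suc d)      ∎
    where
    s : ℕ
    s = S (suc k′) (suc d)

  signedStirling-suc : ∀ k d →
    signedStirling (suc k) (suc d) ≈ - fromℕ (suc d) * signedStirling k (suc d) + signedStirling k d
  signedStirling-suc k d = begin
    fromℕ (suc d ℕ.* S k (suc d) ℕ.+ S k d) * e
      ≈⟨ *-congʳ (trans (fromℕ-homo-+ (suc d ℕ.* S k (suc d)) (S k d)) (+-congʳ (fromℕ-homo-* (suc d) (S k (suc d))))) ⟩
    (fromℕ (suc d) * fromℕ (S k (suc d)) + fromℕ (S k d)) * e    ≈⟨ distribʳ _ _ _ ⟩
    fromℕ (suc d) * fromℕ (S k (suc d)) * e + signedStirling k d ≈⟨ +-congʳ (*-assoc _ _ _) ⟩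
    fromℕ (suc d) * (fromℕ (S k (suc d)) * e) + signedStirling k d
      ≈⟨ +-congʳ (*-congˡ (S-suc*sign≈-signedStirling k d)) ⟩
    fromℕ (suc d) * - signedStirling k (suc d) + signedStirling k d
      ≈⟨ +-congʳ (trans (sym (-‿distribʳ-* _ _)) (-‿distribˡ-* _ _)) ⟩
    - fromℕ (suc d) * signedStirling k (suc d) + signedStirling k d ∎
    where
    e : Carrier
    e = (- 1#) ^ (k ∸ d)

  module _ (x : Carrier) where

    binomialWeight : ℕ → ℕ → Carrier
    binomialWeight n k = fromℕ (n C k) * x ^ (n ∸ k)

    binomialWeight-beyond : ∀ {n k} → n < k → binomialWeight n k ≈ 0#
    binomialWeight-beyond {n} {k} n<k = begin
      fromℕ (n C k) * x ^ (n ∸ k) ≡⟨ ≡.cong (λ c → fromℕ c * x ^ (n ∸ k)) (k>n⇒nCk≡0 n<k) ⟩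
      0# * x ^ (n ∸ k)            ≈⟨ zeroˡ _ ⟩
      0#                          ∎

    binomialWeight-suc-zero : ∀ n → binomialWeight (suc n) 0 ≈ x * binomialWeight n 0
    binomialWeight-suc-zero n = x*yz≈y*xz (fromℕ 1) x (x ^ n)

    -- n ∸ k = 1 + (n ∸ suc k) needs k < n; otherwise n C suc k = 0
    binomialWeight-shift : ∀ n k → fromℕ (n C suc k) * x ^ (n ∸ k) ≈ x * binomialWeight n (suc k)
    binomialWeight-shift n k with ℕ.≤-<-connex n k
    ... | inj₁ n≤k = begin
      fromℕ (n C suc k) * x ^ (n ∸ k) ≡⟨ ≡.cong (λ c → fromℕ c * x ^ (n ∸ k)) (k>n⇒nCk≡0 (s≤s n≤k)) ⟩
      0# * x ^ (n ∸ k)                ≈⟨ zeroˡ _ ⟩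
      0#                              ≈⟨ zeroʳ x ⟨
      x * 0#                          ≈⟨ *-congˡ (binomialWeight-beyond (s≤s n≤k)) ⟨
      x * binomialWeight n (suc k)    ∎
    ... | inj₂ (s≤s {n = m} k≤m) = begin
      fromℕ (suc m C suc k) * x ^ (suc m ∸ k)       ≡⟨ ≡.cong (λ e → fromℕ (suc m C suc k) * x ^ e) (ℕ.+-∸-assoc 1 k≤m) ⟩
      fromℕ (suc m C suc k) * (x * x ^ (m ∸ k))     ≈⟨ x*yz≈y*xz _ x _ ⟩
      x * binomialWeight (suc m) (suc k)            ∎

    binomialWeight-pascal : ∀ n k →
      binomialWeight (suc n) (suc k) ≈ binomialWeight n k + x * binomialWeight n (suc k)
    binomialWeight-pascal n k = begin
      fromℕ (suc n C suc k) * x ^ (n ∸ k)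
        ≡⟨ ≡.cong (λ c → fromℕ c * x ^ (n ∸ k)) (nCk+nC[k+1]≡[n+1]C[k+1] n k) ⟨
      fromℕ (n C k ℕ.+ n C suc k) * x ^ (n ∸ k)                   ≈⟨ *-congʳ (fromℕ-homo-+ (n C k) _) ⟩
      (fromℕ (n C k) + fromℕ (n C suc k)) * x ^ (n ∸ k)           ≈⟨ distribʳ _ _ _ ⟩
      binomialWeight n k + fromℕ (n C suc k) * x ^ (n ∸ k)        ≈⟨ +-congˡ (binomialWeight-shift n k) ⟩
      binomialWeight n k + x * binomialWeight n (suc k)           ∎

    binomialTransform : (ℕ → Carrier) → ℕ → Carrier
    binomialTransform a n = ∑[ k < suc n ] (binomialWeight n (toℕ k) * a (toℕ k))

    binomialTransform-cong : ∀ {a b : ℕ → Carrier} → (∀ k → a k ≈ b k) →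
      ∀ n → binomialTransform a n ≈ binomialTransform b n
    binomialTransform-cong a≈b n = sum-cong-≋ {suc n} (λ k → *-congˡ {binomialWeight n (toℕ k)} (a≈b (toℕ k)))

    binomialTransform-linear : ∀ c (a b : ℕ → Carrier) n →
      binomialTransform (λ k → c * a k + b k) n ≈ c * binomialTransform a n + binomialTransform b n
    binomialTransform-linear c a b n = begin
      ∑[ k < suc n ] (w k * (c * a (toℕ k) + b (toℕ k)))
        ≈⟨ sum-cong-≋ {suc n} (λ k → trans (distribˡ (w k) _ (b (toℕ k))) (+-congʳ (x*yz≈y*xz (w k) c (a (toℕ k))))) ⟩
      ∑[ k < suc n ] (c * wa k + wb k)           ≈⟨ ∑-distrib-+ (λ k → c * wa k) wb ⟩
      ∑[ k < suc n ] (c * wa k) + ∑[ k < suc n ] wb k  ≈⟨ +-congʳ (*-distribˡ-sum c wa) ⟨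
      c * binomialTransform a n + binomialTransform b n ∎
      where
      w wa wb : Fin.Fin (suc n) → Carrier
      w k  = binomialWeight n (toℕ k)
      wa k = w k * a (toℕ k)
      wb k = w k * b (toℕ k)

    binomialTransform-head : ∀ (a : ℕ → Carrier) → (∀ k → a (suc k) ≈ 0#) →
      ∀ n → binomialTransform a n ≈ x ^ n * a 0
    binomialTransform-head a tail≈0 n = begin
      binomialWeight n 0 * a 0 + ∑[ k < n ] (binomialWeight n (suc (toℕ k)) * a (suc (toℕ k)))
        ≈⟨ +-congˡ (∑-zero n _ (λ k → trans (*-congˡ (tail≈0 (toℕ k))) (zeroʳ _))) ⟩
      (1# + 0#) * x ^ n * a 0 + 0#  ≈⟨ +-identityʳ _ ⟩
      (1# + 0#) * x ^ n * a 0       ≈⟨ *-congʳ (trans (*-congʳ (+-identityʳ 1#)) (*-identityˡ _)) ⟩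
      x ^ n * a 0                   ∎

    binomialTransform-suc : ∀ (a : ℕ → Carrier) n →
      binomialTransform a (suc n) ≈ x * binomialTransform a n + binomialTransform (a ∘ suc) n
    binomialTransform-suc a n = begin
      binomialWeight (suc n) 0 * a 0 + ∑[ k < suc n ] (binomialWeight (suc n) (suc (toℕ k)) * a (suc (toℕ k)))
        ≈⟨ +-cong (trans (*-congʳ (binomialWeight-suc-zero n)) (*-assoc _ _ _)) (sum-cong-≋ {suc n} (pascal ∘ toℕ)) ⟩
      x * t 0 + ∑[ k < suc n ] (binomialWeight n (toℕ k) * a (suc (toℕ k)) + x * t (suc (toℕ k)))
        ≈⟨ +-congˡ (∑-distrib-+ {suc n} (λ k → binomialWeight n (toℕ k) * a (suc (toℕ k))) (λ k → x * t (suc (toℕ k)))) ⟩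
      x * t 0 + (binomialTransform (a ∘ suc) n + ∑[ k < suc n ] (x * t (suc (toℕ k))))
        ≈⟨ +-congˡ (+-congˡ (*-distribˡ-sum {suc n} x (λ k → t (suc (toℕ k))))) ⟨
      x * t 0 + (binomialTransform (a ∘ suc) n + x * ∑[ k < suc n ] t (suc (toℕ k)))
        ≈⟨ +-congˡ (+-congˡ (*-congˡ (∑-dropLast n (t ∘ suc) t-beyond))) ⟩
      x * t 0 + (binomialTransform (a ∘ suc) n + x * ∑[ k < n ] t (suc (toℕ k)))
        ≈⟨ x+yz≈xz+y _ _ _ ⟩
      (x * t 0 + x * ∑[ k < n ] t (suc (toℕ k))) + binomialTransform (a ∘ suc) n
        ≈⟨ +-congʳ (distribˡ x _ _) ⟨
      x * binomialTransform a n + binomialTransform (a ∘ suc) n ∎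
      where
      t : ℕ → Carrier
      t k = binomialWeight n k * a k

      t-beyond : t (suc n) ≈ 0#
      t-beyond = trans (*-congʳ (binomialWeight-beyond (ℕ.n<1+n n))) (zeroˡ _)

      pascal : ∀ k → binomialWeight (suc n) (suc k) * a (suc k) ≈ binomialWeight n k * a (suc k) + x * t (suc k)
      pascal k = begin
        binomialWeight (suc n) (suc k) * a (suc k)                           ≈⟨ *-congʳ (binomialWeight-pascal n k) ⟩
        (binomialWeight n k + x * binomialWeight n (suc k)) * a (suc k)     ≈⟨ distribʳ _ _ _ ⟩
        binomialWeight n k * a (suc k) + (x * binomialWeight n (suc k)) * a (suc k) ≈⟨ +-congˡ (*-assoc _ _ _) ⟩
        binomialWeight n k * a (suc k) + x * t (suc k)                       ∎

    -- h n d = h_{n−d}(x, x − 1, …, x − d), which is 0 for n < d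
    h : ℕ → ℕ → Carrier
    h n       zero    = x ^ n
    h zero    (suc d) = 0#
    h (suc n) (suc d) = (x - fromℕ (suc d)) * h n (suc d) + h n d

    binomialTransform-signedStirling : ∀ n d → binomialTransform (λ k → signedStirling k d) n ≈ h n d
    binomialTransform-signedStirling n zero = begin
      binomialTransform (λ k → signedStirling k 0) n ≈⟨ binomialTransform-head (λ k → signedStirling k 0) (λ _ → zeroˡ _) n ⟩
      x ^ n * ((1# + 0#) * 1#)                      ≈⟨ *-congˡ (trans (*-identityʳ _) (+-identityʳ 1#)) ⟩
      x ^ n * 1#                                    ≈⟨ *-identityʳ _ ⟩
      x ^ n                                         ∎
    binomialTransform-signedStirling zero (suc d) =
      trans (+-identityʳ _) (trans (*-congˡ (zeroˡ _)) (zeroʳ _))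
    binomialTransform-signedStirling (suc n) (suc d) = begin
      B s′ (suc n)                                ≈⟨ binomialTransform-suc s′ n ⟩
      x * B s′ n + B (s′ ∘ suc) n                 ≈⟨ +-congˡ (binomialTransform-cong (λ k → signedStirling-suc k d) n) ⟩
      x * B s′ n + B (λ k → c * s′ k + s k) n     ≈⟨ +-congˡ (binomialTransform-linear c s′ s n) ⟩
      x * B s′ n + (c * B s′ n + B s n)           ≈⟨ +-cong (*-congˡ IH′) (+-cong (*-congˡ IH′) IH) ⟩
      x * h n (suc d) + (c * h n (suc d) + h n d) ≈⟨ +-assoc _ _ _ ⟨
      x * h n (suc d) + c * h n (suc d) + h n d   ≈⟨ +-congʳ (distribʳ _ _ _) ⟨
      h (suc n) (suc d)                           ∎
      where
      B : (ℕ → Carrier) → ℕ → Carrier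
      B = binomialTransform
      c : Carrier
      c = - fromℕ (suc d)
      s s′ : ℕ → Carrier
      s  k = signedStirling k d
      s′ k = signedStirling k (suc d)
      IH : B s n ≈ h n d
      IH = binomialTransform-signedStirling n d
      IH′ : B s′ n ≈ h n (suc d)
      IH′ = binomialTransform-signedStirling n (suc d)

    lhsTerm≈binomialWeight*signedStirling : ∀ n d k →
      lhsTerm n d x k ≈ binomialWeight n k * signedStirling k d
    lhsTerm≈binomialWeight*signedStirling n d k = begin
      fromℕ ((n C k) ℕ.* S k d) * ((- 1#) ^ (k ∸ d) * x ^ (n ∸ k))
        ≈⟨ *-cong (fromℕ-homo-* (n C k) (S k d)) (*-comm _ _) ⟩
      fromℕ (n C k) * fromℕ (S k d) * (x ^ (n ∸ k) * (- 1#) ^ (k ∸ d)) ≈⟨ interchange _ _ _ _ ⟩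
      binomialWeight n k * signedStirling k d                           ∎

    lhs≈h : ∀ n d → d ≤ suc n → lhs n d x ≈ h n d
    lhs≈h n d d≤1+n = begin
      lhs n d x                                   ≡⟨ sumR-map-map-upTo (lhsTerm n d x) (d ℕ.+_) (suc n ∸ d) ⟩
      ∑[ i < suc n ∸ d ] lhsTerm n d x (d ℕ.+ toℕ i)
        ≈⟨ sum-cong-≋ {suc n ∸ d} (λ i → lhsTerm≈binomialWeight*signedStirling n d (d ℕ.+ toℕ i)) ⟩
      ∑[ i < suc n ∸ d ] t (d ℕ.+ toℕ i)          ≈⟨ ∑-suffix t d≤1+n t-vanishes ⟩
      binomialTransform (λ k → signedStirling k d) n ≈⟨ binomialTransform-signedStirling n d ⟩
      h n d                                       ∎
      where
      t : ℕ → Carrier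
      t k = binomialWeight n k * signedStirling k d
      t-vanishes : ∀ {k} → k < d → t k ≈ 0#
      t-vanishes k<d = trans (*-congˡ (signedStirling-vanishes k<d)) (zeroʳ _)

    h-unfold : ∀ k m →
      h k (suc m) ≈ ∑[ i < k ] ((x - fromℕ (suc m)) ^ toℕ i * h (k ∸ suc (toℕ i)) m)
    h-unfold zero    m = refl
    h-unfold (suc k) m = begin
      y * h k (suc m) + h k m                                   ≈⟨ +-comm _ _ ⟩
      h k m + y * h k (suc m)                                   ≈⟨ +-cong (*-identityˡ _) (*-congˡ (sym (h-unfold k m))) ⟨
      1# * h k m + y * ∑[ i < k ] g i                           ≈⟨ +-congˡ (*-distribˡ-sum y g) ⟩
      1# * h k m + ∑[ i < k ] (y * g i)                         ≈⟨ +-congˡ (sum-cong-≋ {k} (λ _ → *-assoc _ _ _)) ⟨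
      1# * h k m + ∑[ i < k ] (y * y ^ toℕ i * h (k ∸ suc (toℕ i)) m) ∎
      where
      y : Carrier
      y = x - fromℕ (suc m)
      g : Fin.Fin k → Carrier
      g i = y ^ toℕ i * h (k ∸ suc (toℕ i)) m

    gapProduct : ℕ → ℕ → List ℕ → Carrier
    gapProduct e a []       = 1#
    gapProduct e a (j ∷ js) = (x - fromℕ e) ^ (j ∸ a ∸ 1) * gapProduct (ℕ.pred e) j js

    lastOr : ℕ → List ℕ → ℕ
    lastOr a []       = a
    lastOr a (j ∷ js) = lastOr j js

    chainSum : ℕ → ℕ → ℕ → Carrier
    chainSum m a n = sumR (map (λ js → x ^ (n ∸ lastOr a js) * gapProduct m a js) (chains m a n))

    chainSum≈h : ∀ m a n → chainSum m a n ≈ h (n ∸ a) m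
    chainSum≈h zero    a n = trans (+-identityʳ _) (*-identityʳ _)
    chainSum≈h (suc m) a n = begin
      sumR (map t (concatMap G (range a n)))              ≈⟨ sumR-map-concatMap t G (range a n) ⟩
      sumR (map (λ j → sumR (map t (G j))) (range a n))   ≈⟨ sumR-map-cong sum-over-first (range a n) ⟩
      sumR (map Φ (range a n))                            ≡⟨ sumR-map-map-upTo Φ (λ i → a ℕ.+ suc i) (n ∸ a) ⟩
      ∑[ i < n ∸ a ] Φ (a ℕ.+ suc (toℕ i))                ≡⟨ sum-cong-≗ {n ∸ a} (Φ-shift ∘ toℕ) ⟩
      ∑[ i < n ∸ a ] (y ^ toℕ i * h (n ∸ a ∸ suc (toℕ i)) m) ≈⟨ h-unfold (n ∸ a) m ⟨
      h (n ∸ a) (suc m)                                   ∎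
      where
      y : Carrier
      y = x - fromℕ (suc m)

      t : List ℕ → Carrier
      t js = x ^ (n ∸ lastOr a js) * gapProduct (suc m) a js

      G : ℕ → List (List ℕ)
      G j = map (j ∷_) (chains m j n)

      Φ : ℕ → Carrier
      Φ j = y ^ (j ∸ a ∸ 1) * h (n ∸ j) m

      sum-over-first : ∀ j → sumR (map t (G j)) ≈ Φ j
      sum-over-first j = begin
        sumR (map t (map (j ∷_) (chains m j n)))  ≡⟨ ≡.cong sumR (map-∘ (chains m j n)) ⟨
        sumR (map (t ∘ (j ∷_)) (chains m j n))    ≈⟨ sumR-map-cong (λ _ → x*yz≈y*xz _ _ _) (chains m j n) ⟩
        sumR (map (λ js → y ^ (j ∸ a ∸ 1) * (x ^ (n ∸ lastOr j js) * gapProduct m j js)) (chains m j n))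
          ≈⟨ *-distribˡ-sumR _ _ (chains m j n) ⟨
        y ^ (j ∸ a ∸ 1) * chainSum m j n          ≈⟨ *-congˡ (chainSum≈h m j n) ⟩
        Φ j                                       ∎

      Φ-shift : ∀ i → Φ (a ℕ.+ suc i) ≡ y ^ i * h (n ∸ a ∸ suc i) m
      Φ-shift i = ≡.cong₂ (λ p q → y ^ (p ∸ 1) * h q m)
        (ℕ.m+n∸m≡n a (suc i)) (≡.sym (ℕ.∸-+-assoc n a (suc i)))

    lastOr0-∷ : ∀ j js → lastOr0 (j ∷ js) ≡ lastOr j js
    lastOr0-∷ j []       = ≡.refl
    lastOr0-∷ j (k ∷ ks) = lastOr0-∷ k ks

    lastOr0≡lastOr-0 : ∀ js → lastOr0 js ≡ lastOr 0 js
    lastOr0≡lastOr-0 []       = ≡.refl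
    lastOr0≡lastOr-0 (j ∷ js) = lastOr0-∷ j js

    prodTerm≡gapProduct : ∀ d r a js → prodTerm d x a r js ≡ gapProduct (d ∸ r) a js
    prodTerm≡gapProduct d r a []       = ≡.refl
    prodTerm≡gapProduct d r a (j ∷ js) = ≡.cong ((x - fromℕ (d ∸ r)) ^ (j ∸ a ∸ 1) *_)
      (≡.trans (prodTerm≡gapProduct d (suc r) j js)
               (≡.cong (λ e → gapProduct e j js) (≡.sym (ℕ.pred[m∸n]≡m∸[1+n] d r))))

    rhs≈h : ∀ n d → rhs n d x ≈ h n d
    rhs≈h n d = trans (sumR-map-cong rhsTerm≈chainTerm (chains d 0 n)) (chainSum≈h d 0 n)
      where
      rhsTerm≈chainTerm : ∀ js → rhsTerm n d x js ≈ x ^ (n ∸ lastOr 0 js) * gapProduct d 0 js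
      rhsTerm≈chainTerm js = reflexive (≡.cong₂ (λ l p → x ^ (n ∸ l) * p)
        (lastOr0≡lastOr-0 js) (prodTerm≡gapProduct d 0 0 js))

-- The identity holds for d = 0 as well.
mainTheorem4 : {c ℓ : Level} (R : CommutativeRing c ℓ) →
    (n d : ℕ) → 1 ≤ d → d ≤ n → (x : CommutativeRing.Carrier R) →
    CommutativeRing._≈_ R (RingDefs.lhs R n d x) (RingDefs.rhs R n d x)
mainTheorem4 R n d _ d≤n x =
  trans (lhs≈h R x n d (ℕ.m≤n⇒m≤1+n d≤n)) (sym (rhs≈h R x n d))
  where open CommutativeRing R using (trans; sym)
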